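{- Let $\mathcal{A}$ be a strongly connected NFA with $m$ states, let $\varepsilon>0$, let $u$ be a word of length $n\ge 6m^2/\varepsilon$, and assume $L(\mathcal{A})$ contains at least one word of length $n$. If $\tau=\langle 0:u\rangle$ is $\varepsilon$-far from $\widehat L(\mathcal{A})$, then $\tau$ contains at least $\varepsilon n/(6m^2)$ pairwise disjoint blocking factors.
   Context: $\mathcal{A}=(Q,\Sigma,\delta,q_0,F)$ is an NFA whose underlying graph is strongly connected, with period $\lambda$ (gcd of its cycle lengths). A $\lambda$-positional word is a word over $(\mathbb{Z}/\lambda\mathbb{Z})\times\Sigma$ of the form $(n\bmod\lambda,a_0)((n+1)\bmod\lambda,a_1)\cdots((n+\ell)\bmod\lambda,a_\ell)$, written $\langle n:u\rangle$ with $u=a_0\cdots a_\ell$. $\widehat L(\mathcal{A})=\{\langle 0:v\rangle: v\in L(\mathcal{A})\}$. A positional word $\tau'$ is a blocking factor of $\mathcal{A}$ if every positional word having $\tau'$ as a factor is not in $\widehat L(\mathcal{A})$. Distance is Hamming distance ($+\infty$ for different lengths); a positional word $\tau$ of length $n$ is $\varepsilon$-far from a language $L'$ if its Hamming distance to every word of $L'$ is at least $\varepsilon n$. Disjoint factors are occurrences at disjoint sets of positions.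
   Formalization: The parameter ε ranges over the positive rationals. -}

module Defs where

open import Data.Nat using (ℕ; zero; suc; _+_; _*_; _≤_; NonZero)
open import Data.Nat.DivMod using (_mod_)
open import Data.Nat.Divisibility using (_∣_)
open import Data.Fin using (Fin)
open import Data.Fin.Properties using () renaming (_≟_ to _≟ᶠ_)
open import Data.Bool using (Bool; true)
open import Data.List using (List; []; _∷_; length; take; drop; _++_)
open import Data.Product using (Σ; ∃; ∃-syntax; _×_; _,_)
open import Data.Product.Properties using (≡-dec)
open import Data.Sum using (_⊎_)
open import Relation.Nullary using (¬_; yes; no)
open import Relation.Binary.PropositionalEquality using (_≡_)

-- The transition relation δ p a q holds iff
-- q ∈ δ(p,a); the accepting set F is given by its characteristic function.
record NFA (m k : ℕ) : Set where
  field
    δ  : Fin m → Fin k → Fin m → Bool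
    q₀ : Fin m
    F  : Fin m → Bool

module _ {m k : ℕ} (A : NFA m k) where
  open NFA A

  data Path : Fin m → List (Fin k) → Fin m → Set where
    nil  : ∀ {p} → Path p [] p
    step : ∀ {p a r w q} → δ p a r ≡ true → Path r w q → Path p (a ∷ w) q

  Accepts : List (Fin k) → Set
  Accepts w = ∃[ q ] (Path q₀ w q × F q ≡ true)

  StronglyConnected : Set
  StronglyConnected = ∀ p q → ∃[ w ] Path p w q

  CycleLength : ℕ → Set
  CycleLength ℓ = 1 ≤ ℓ × ∃[ p ] ∃[ w ] (Path p w p × length w ≡ ℓ)

  IsPeriod : ℕ → Set
  IsPeriod λ′ = (∀ ℓ → CycleLength ℓ → λ′ ∣ ℓ)
              × (∀ d → (∀ ℓ → CycleLength ℓ → d ∣ ℓ) → d ∣ λ′)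

-- Positional words: words over (ℤ/λℤ) × Σ, with ℤ/λℤ represented by Fin λ.
PosWord : ℕ → ℕ → Set
PosWord λ′ k = List (Fin λ′ × Fin k)

⟨_∶_⟩ : ∀ {λ′ k} .{{_ : NonZero λ′}} → ℕ → List (Fin k) → PosWord λ′ k
⟨_∶_⟩ {λ′} n []      = []
⟨_∶_⟩ {λ′} n (a ∷ u) = (n mod λ′ , a) ∷ ⟨ suc n ∶ u ⟩

InLhat : ∀ {m k} (A : NFA m k) (λ′ : ℕ) .{{_ : NonZero λ′}} → PosWord λ′ k → Set
InLhat A λ′ σ = ∃[ v ] (Accepts A v × σ ≡ ⟨ 0 ∶ v ⟩)

IsFactor : ∀ {X : Set} → List X → List X → Set
IsFactor {X} τ′ σ = ∃[ p ] ∃[ s ] (σ ≡ p ++ (τ′ ++ s))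

Blocking : ∀ {m k} (A : NFA m k) (λ′ : ℕ) .{{_ : NonZero λ′}} → PosWord λ′ k → Set
Blocking A λ′ τ′ = ∀ σ → IsFactor τ′ σ → ¬ InLhat A λ′ σ

-- Words of different lengths are at
-- distance +∞; this case is handled separately where the distance is used.
hamming : ∀ {λ′ k} → PosWord λ′ k → PosWord λ′ k → ℕ
hamming []       _        = 0
hamming (_ ∷ _)  []       = 0
hamming (x ∷ xs) (y ∷ ys) with ≡-dec _≟ᶠ_ _≟ᶠ_ x y
... | yes _ = hamming xs ys
... | no  _ = suc (hamming xs ys)

-- The occurrence (i , ℓ) of a factor of τ: positions i, …, i+ℓ-1.
slice : ∀ {X : Set} → ℕ × ℕ → List X → List X
slice (i , ℓ) τ = take ℓ (drop i τ)

DisjointOcc : ℕ × ℕ → ℕ × ℕ → Set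
DisjointOcc (i , ℓ) (j , ℓ′) = (i + ℓ ≤ j) ⊎ (j + ℓ′ ≤ i)

BlockingOcc : ∀ {m k} (A : NFA m k) (λ′ : ℕ) .{{_ : NonZero λ′}} →
              PosWord λ′ k → ℕ × ℕ → Set
BlockingOcc A λ′ τ (i , ℓ) =
  1 ≤ ℓ × i + ℓ ≤ length τ × Blocking A λ′ (slice (i , ℓ) τ)

{-# OPTIONS --safe #-}
module Submission where

-- The phase of a state is the length modulo λ of the walks from q₀ to it; it is well defined
-- because closed walks have length divisible by λ. Conversely, between two states every length
-- G ≥ m² compatible with their phases is realised by a walk: a cycle of length s ≤ m through the
-- source makes the sets of states reachable in m s + x steps periodic in x, with a period
-- dividing λ.
-- Cut u greedily: from position i take the longest factor x readable from a state of phase i,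
-- together with the next letter a; then ⟨ i ∶ x a ⟩ is a blocking factor. With t such cuts, an
-- accepted word is obtained by following the readable factors and rewriting at most m² + 1
-- letters around each cut and m² at each end along walks of the right lengths, so u is within
-- t (m² + 1) + 2 m² ≤ 6 m² t of L(A), and farness forces 6 m² t ≥ ε n.

open import Defs

-- Anonymous module: its ℕ-level imports (_≤_, _/_, …) must not reach the ℚ-level statement below.
module _ where
  open import Data.Nat using (ℕ; zero; suc; _+_; _*_; _∸_; _≤_; _<_; _≤?_; z≤n; s≤s; s≤s⁻¹; NonZero; ≢-nonZero⁻¹)
  open import Data.Nat.Properties
  open import Data.Nat.DivMod
    using (_%_; _/_; _mod_; %-distribˡ-+; [m+kn]%n≡m%n; %-remove-+ˡ; %-remove-+ʳ; m%n<n; m≡m%n+[m/n]*n; m∣n⇒o%n%m≡o%m)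
  open import Data.Nat.Divisibility using (_∣_; _∣0; 0∣⇒≡0; ∣m+n∣m⇒∣n; ∣n⇒∣m*n; m%n≡0⇒n∣m)
  open import Data.Nat.Coprimality using (1-coprimeTo) renaming (sym to coprime-sym)
  open import Data.Nat.Induction using (<-wellFounded)
  open import Data.Nat.Tactic.RingSolver using (solve-∀)
  import Data.Integer as ℤ
  import Data.Integer.Properties as ℤ
  import Data.Rational as ℚ
  open import Data.Rational.Properties using (normalize-coprime)
  open import Data.Bool using (true)
  open import Data.Bool.Properties using () renaming (_≟_ to _≟ᵇ_)
  open import Data.Fin using (Fin; toℕ)
  open import Data.Fin.Properties using (any?; pigeonhole; toℕ≤pred[n]; toℕ-fromℕ<; nonZeroIndex) renaming (_≟_ to _≟ᶠ_)
  open import Data.List using (List; []; _∷_; length; _++_; _∷ʳ_)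
  open import Data.List.Properties
    using (∷-injectiveˡ; ∷-injectiveʳ; length-++; length-++-≤ˡ; ++-assoc; ++-identityʳ; ++-conicalʳ; ∷ʳ-++)
  open import Data.List.Relation.Unary.All as All using (All; []; _∷_)
  open import Data.List.Relation.Unary.AllPairs using (AllPairs; []; _∷_)
  open import Data.Product using (∃; ∃-syntax; ∃₂; _×_; _,_; proj₁; proj₂)
  open import Data.Product.Properties using (≡-dec; ,-injective; ,-injectiveʳ)
  open import Data.Sum using (_⊎_; inj₁; inj₂)
  open import Induction.WellFounded using (Acc; acc)
  open import Relation.Nullary using (¬_; Dec; yes; no; contradiction)
  open import Relation.Nullary.Decidable using (_×-dec_; map′)
  open import Relation.Unary using (Pred; Decidable)
  open import Relation.Binary.PropositionalEquality

  +n/1≡mkℚ : ∀ n → ℤ.+ n ℚ./ 1 ≡ ℚ.mkℚ (ℤ.+ n) 0 (coprime-sym (1-coprimeTo n))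
  +n/1≡mkℚ n = normalize-coprime (coprime-sym (1-coprimeTo n))

  /1-mono-≤ : ∀ {a b} → a ≤ b → ℤ.+ a ℚ./ 1 ℚ.≤ ℤ.+ b ℚ./ 1
  /1-mono-≤ {a} {b} a≤b rewrite +n/1≡mkℚ a | +n/1≡mkℚ b =
    ℚ.*≤* (subst₂ ℤ._≤_ (sym (ℤ.*-identityʳ (ℤ.+ a))) (sym (ℤ.*-identityʳ (ℤ.+ b))) (ℤ.+≤+ a≤b))

  /1-cancel-≤ : ∀ {a b} → ℤ.+ a ℚ./ 1 ℚ.≤ ℤ.+ b ℚ./ 1 → a ≤ b
  /1-cancel-≤ {a} {b} p rewrite +n/1≡mkℚ a | +n/1≡mkℚ b with p
  ... | ℚ.*≤* q = ℤ.drop‿+≤+ (subst₂ ℤ._≤_ (ℤ.*-identityʳ (ℤ.+ a)) (ℤ.*-identityʳ (ℤ.+ b)) q)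

  %-cancelˡ-+ : ∀ x {a b d} .{{_ : NonZero d}} → (x + a) % d ≡ (x + b) % d → a % d ≡ b % d
  %-cancelˡ-+ x {a} {b} {d@(suc d′)} eq = begin
    a % d                            ≡⟨ sym ([m+kn]%n≡m%n a x d) ⟩
    (a + x * d) % d                  ≡⟨ cong (_% d) (shift a) ⟩
    ((x + a) + d′ * x) % d           ≡⟨ %-distribˡ-+ (x + a) (d′ * x) d ⟩
    ((x + a) % d + d′ * x % d) % d   ≡⟨ cong (λ r → (r + d′ * x % d) % d) eq ⟩
    ((x + b) % d + d′ * x % d) % d   ≡⟨ %-distribˡ-+ (x + b) (d′ * x) d ⟨
    ((x + b) + d′ * x) % d           ≡⟨ cong (_% d) (shift b) ⟨
    (b + x * d) % d                  ≡⟨ [m+kn]%n≡m%n b x d ⟩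
    b % d                            ∎
    where
    open ≡-Reasoning
    shift : ∀ c → c + x * d ≡ (x + c) + d′ * x
    shift c = begin
      c + x * suc d′     ≡⟨ cong (c +_) (*-suc x d′) ⟩
      c + (x + x * d′)   ≡⟨ cong (λ t → c + (x + t)) (*-comm x d′) ⟩
      c + (x + d′ * x)   ≡⟨ +-assoc c x (d′ * x) ⟨
      (c + x) + d′ * x   ≡⟨ cong (_+ d′ * x) (+-comm c x) ⟩
      (x + c) + d′ * x   ∎

  %-+-congˡ : ∀ {a b} c {d} .{{_ : NonZero d}} → a % d ≡ b % d → (a + c) % d ≡ (b + c) % d
  %-+-congˡ {a} {b} c {d} eq = begin
    (a + c) % d              ≡⟨ %-distribˡ-+ a c d ⟩
    (a % d + c % d) % d      ≡⟨ cong (λ r → (r + c % d) % d) eq ⟩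
    (b % d + c % d) % d      ≡⟨ %-distribˡ-+ b c d ⟨
    (b + c) % d              ∎
    where open ≡-Reasoning

  ∣+∣+⇒%≡ : ∀ a b c {d} .{{_ : NonZero d}} → d ∣ a + c → d ∣ b + c → a % d ≡ b % d
  ∣+∣+⇒%≡ a b c {d} d∣a+c d∣b+c = begin
    a % d              ≡⟨ %-remove-+ʳ a d∣b+c ⟨
    (a + (b + c)) % d  ≡⟨ cong (_% d) (swap a b c) ⟩
    ((a + c) + b) % d  ≡⟨ %-remove-+ˡ b d∣a+c ⟩
    b % d              ∎
    where
    open ≡-Reasoning
    swap : ∀ a b c → a + (b + c) ≡ (a + c) + b
    swap a b c = trans (cong (a +_) (+-comm b c)) (sym (+-assoc a c b))

  mod≡⇒%≡ : ∀ i j {d} .{{_ : NonZero d}} → i mod d ≡ j mod d → i % d ≡ j % d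
  mod≡⇒%≡ i j eq = trans (sym (toℕ-fromℕ< _)) (trans (cong toℕ eq) (toℕ-fromℕ< _))

  least-witness : ∀ {ℓ} {P : Pred ℕ ℓ} → Decidable P → ∀ {b} → P b → ∃[ g ] (P g × (∀ {j} → j < g → ¬ P j))
  least-witness P? {zero} P0 = 0 , P0 , λ ()
  least-witness {P = P} P? {suc b} Pb with P? 0
  ... | yes P0 = 0 , P0 , λ ()
  ... | no ¬P0 with least-witness (λ j → P? (suc j)) Pb
  ...   | g , Pg , below = suc g , Pg , minimal
    where
    minimal : ∀ {j} → j < suc g → ¬ P j
    minimal {zero}  _         = ¬P0
    minimal {suc j} (s≤s j<g) = below j<g

  split-at : ∀ {X : Set} i (xs : List X) → i ≤ length xs → ∃₂ λ ys zs → xs ≡ ys ++ zs × length ys ≡ i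
  split-at zero    xs       _         = [] , xs , refl , refl
  split-at (suc i) (x ∷ xs) (s≤s i≤n) with split-at i xs i≤n
  ... | ys , zs , refl , refl = x ∷ ys , zs , refl , refl

  slice-++ : ∀ {X : Set} (xs ys zs : List X) {i ℓ} → length xs ≡ i → length ys ≡ ℓ → slice (i , ℓ) (xs ++ ys ++ zs) ≡ ys
  slice-++ []       []       zs refl refl = refl
  slice-++ []       (y ∷ ys) zs refl refl = cong (y ∷_) (slice-++ [] ys zs refl refl)
  slice-++ (x ∷ xs) ys       zs refl refl = slice-++ xs ys zs refl refl

  prefix-breakpoint : ∀ {X : Set} {ℓ} {P : Pred (List X) ℓ} → Decidable P → P [] → ∀ z →
    P z ⊎ ∃[ x ] ∃[ a ] ∃[ z′ ] (z ≡ x ++ a ∷ z′ × P x × ¬ P (x ∷ʳ a))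
  prefix-breakpoint P? P[] []      = inj₁ P[]
  prefix-breakpoint P? P[] (b ∷ z) with P? (b ∷ [])
  ... | no ¬Pb = inj₂ ([] , b , z , refl , P[] , ¬Pb)
  ... | yes Pb with prefix-breakpoint (λ w → P? (b ∷ w)) Pb z
  ...   | inj₁ Pbz = inj₁ Pbz
  ...   | inj₂ (x , a , z′ , refl , Pbx , ¬Pbxa) = inj₂ (b ∷ x , a , z′ , refl , Pbx , ¬Pbxa)

  +-length-++ : ∀ {X : Set} {i j l} (xs ys : List X) → i + length xs ≡ j → j + length ys ≡ l → i + length (xs ++ ys) ≡ l
  +-length-++ {i = i} xs ys refl refl = trans (cong (i +_) (length-++ xs)) (sym (+-assoc i (length xs) (length ys)))

  +-length-++⁻ : ∀ {X : Set} {i l} (xs ys : List X) → i + length (xs ++ ys) ≡ l → i + length xs + length ys ≡ l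
  +-length-++⁻ xs ys eq = trans (sym (+-length-++ xs ys refl refl)) eq

  length-++-cong : ∀ {X : Set} (xs xs′ ys ys′ : List X) → length xs ≡ length xs′ → length ys ≡ length ys′ →
                   length (xs ++ ys) ≡ length (xs′ ++ ys′)
  length-++-cong xs xs′ _ _ eq eq′ = trans (length-++ xs) (trans (cong₂ _+_ eq eq′) (sym (length-++ xs′)))

  module _ {k : ℕ} where

    mismatches : List (Fin k) → List (Fin k) → ℕ
    mismatches []      _       = 0
    mismatches (_ ∷ _) []      = 0
    mismatches (a ∷ x) (b ∷ y) with a ≟ᶠ b
    ... | yes _ = mismatches x y
    ... | no  _ = suc (mismatches x y)

    mismatches-refl : ∀ x → mismatches x x ≡ 0
    mismatches-refl []      = refl
    mismatches-refl (a ∷ x) with a ≟ᶠ a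
    ... | yes _   = mismatches-refl x
    ... | no  a≢a = contradiction refl a≢a

    mismatches≤length : ∀ x y → mismatches x y ≤ length x
    mismatches≤length []      _       = z≤n
    mismatches≤length (_ ∷ x) []      = z≤n
    mismatches≤length (a ∷ x) (b ∷ y) with a ≟ᶠ b
    ... | yes _ = m≤n⇒m≤1+n (mismatches≤length x y)
    ... | no  _ = s≤s (mismatches≤length x y)

    mismatches-++ : ∀ x x′ {y y′} → length x ≡ length x′ →
                    mismatches (x ++ y) (x′ ++ y′) ≡ mismatches x x′ + mismatches y y′
    mismatches-++ []      []       _   = refl
    mismatches-++ (a ∷ x) (b ∷ x′) len with a ≟ᶠ b
    ... | yes _ = mismatches-++ x x′ (suc-injective len)
    ... | no  _ = cong suc (mismatches-++ x x′ (suc-injective len))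

  module Positional (λ′ : ℕ) .{{_ : NonZero λ′}} {k : ℕ} where

    length-⟨⟩ : ∀ i (x : List (Fin k)) → length (⟨_∶_⟩ {λ′} i x) ≡ length x
    length-⟨⟩ i []      = refl
    length-⟨⟩ i (a ∷ x) = cong suc (length-⟨⟩ (suc i) x)

    ⟨⟩-++ : ∀ i (x y : List (Fin k)) → ⟨_∶_⟩ {λ′} i (x ++ y) ≡ ⟨ i ∶ x ⟩ ++ ⟨ i + length x ∶ y ⟩
    ⟨⟩-++ i []      y = cong (⟨_∶ y ⟩) (sym (+-identityʳ i))
    ⟨⟩-++ i (a ∷ x) y = cong (_ ∷_) (trans (⟨⟩-++ (suc i) x y)
                                           (cong (λ j → ⟨ suc i ∶ x ⟩ ++ ⟨ j ∶ y ⟩) (sym (+-suc i (length x)))))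

    slice-⟨⟩ : ∀ (pre y z : List (Fin k)) →
               slice (length pre , length y) (⟨_∶_⟩ {λ′} 0 (pre ++ y ++ z)) ≡ ⟨ length pre ∶ y ⟩
    slice-⟨⟩ pre y z = begin
      slice (length pre , length y) ⟨ 0 ∶ pre ++ y ++ z ⟩
        ≡⟨ cong (slice (length pre , length y)) (⟨⟩-++ 0 pre (y ++ z)) ⟩
      slice (length pre , length y) (⟨ 0 ∶ pre ⟩ ++ ⟨ length pre ∶ y ++ z ⟩)
        ≡⟨ cong (λ w → slice (length pre , length y) (⟨ 0 ∶ pre ⟩ ++ w)) (⟨⟩-++ (length pre) y z) ⟩
      slice (length pre , length y) (⟨ 0 ∶ pre ⟩ ++ ⟨ length pre ∶ y ⟩ ++ ⟨ length pre + length y ∶ z ⟩)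
        ≡⟨ slice-++ ⟨ 0 ∶ pre ⟩ ⟨ length pre ∶ y ⟩ _ (length-⟨⟩ 0 pre) (length-⟨⟩ (length pre) y) ⟩
      ⟨ length pre ∶ y ⟩ ∎
      where open ≡-Reasoning

    hamming-⟨⟩ : ∀ i (x y : List (Fin k)) → hamming (⟨_∶_⟩ {λ′} i x) ⟨ i ∶ y ⟩ ≡ mismatches x y
    hamming-⟨⟩ i []      _       = refl
    hamming-⟨⟩ i (_ ∷ _) []      = refl
    hamming-⟨⟩ i (a ∷ x) (b ∷ y) with ≡-dec _≟ᶠ_ _≟ᶠ_ (i mod λ′ , a) (i mod λ′ , b) | a ≟ᶠ b
    ... | yes _   | yes _   = hamming-⟨⟩ (suc i) x y
    ... | no  _   | no  _   = cong suc (hamming-⟨⟩ (suc i) x y)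
    ... | yes eq  | no  a≢b = contradiction (,-injectiveʳ eq) a≢b
    ... | no  neq | yes refl = contradiction refl neq

    ⟨⟩-prefix : ∀ i j v (y : List (Fin k)) S → ⟨_∶_⟩ {λ′} i v ≡ ⟨ j ∶ y ⟩ ++ S → ∃[ v′ ] v ≡ y ++ v′
    ⟨⟩-prefix i j v       []      S eq = v , refl
    ⟨⟩-prefix i j (a ∷ v) (b ∷ y) S eq
      with ,-injectiveʳ (∷-injectiveˡ eq) | ⟨⟩-prefix (suc i) (suc j) v y S (∷-injectiveʳ eq)
    ... | refl | v′ , refl = v′ , refl

    ⟨⟩-factor : ∀ i v P {T} {y : List (Fin k)} {S} → ⟨_∶_⟩ {λ′} i v ≡ P ++ ⟨ T ∶ y ⟩ ++ S → y ≢ [] →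
                ∃₂ λ v₁ v₂ → v ≡ v₁ ++ y ++ v₂ × (i + length v₁) % λ′ ≡ T % λ′
    ⟨⟩-factor i v [] {y = []} eq y≢[] = contradiction refl y≢[]
    ⟨⟩-factor i (a ∷ v) [] {T} {b ∷ y} {S} eq _ with ⟨⟩-prefix i T (a ∷ v) (b ∷ y) S eq
    ... | v₂ , refl =
      [] , v₂ , refl , trans (cong (_% λ′) (+-identityʳ i)) (mod≡⇒%≡ i T (proj₁ (,-injective (∷-injectiveˡ eq))))
    ⟨⟩-factor i (a ∷ v) (_ ∷ P) eq y≢[] with ⟨⟩-factor (suc i) v P (∷-injectiveʳ eq) y≢[]
    ... | v₁ , v₂ , refl , pos = a ∷ v₁ , v₂ , refl , trans (cong (_% λ′) (+-suc i (length v₁))) pos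

  module Walks {m k : ℕ} (A : NFA m k) where
    open NFA A

    path-++ : ∀ {p r q x y} → Path A p x r → Path A r y q → Path A p (x ++ y) q
    path-++ nil         py = py
    path-++ (step d px) py = step d (path-++ px py)

    path-split : ∀ {p q} x {y} → Path A p (x ++ y) q → ∃[ r ] (Path A p x r × Path A r y q)
    path-split []      pxy         = _ , nil , pxy
    path-split (a ∷ x) (step d pxy) with path-split x pxy
    ... | r , px , py = r , step d px , py

    readable? : ∀ p x → Dec (∃[ q ] Path A p x q)
    readable? p []      = yes (p , nil)
    readable? p (a ∷ x) = map′ (λ (r , d , q , px) → q , step d px) (λ { (q , step d px) → _ , d , q , px })
                            (any? λ r → (δ p a r ≟ᵇ true) ×-dec readable? r x)

    Walk : ℕ → Fin m → Fin m → Set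
    Walk ℓ p q = ∃[ w ] (Path A p w q × length w ≡ ℓ)

    walk-++ : ∀ {a b p r q} → Walk a p r → Walk b r q → Walk (a + b) p q
    walk-++ (x , px , refl) (y , py , refl) = x ++ y , path-++ px py , length-++ x

    walk-split : ∀ a {b p q} → Walk (a + b) p q → ∃[ r ] (Walk a p r × Walk b r q)
    walk-split zero    w                           = _ , ([] , nil , refl) , w
    walk-split (suc a) (c ∷ w , step d pw , len) with walk-split a (w , pw , suc-injective len)
    ... | r , (x , px , refl) , wy = r , (c ∷ x , step d px , refl) , wy

    walk? : ∀ ℓ p q → Dec (Walk ℓ p q)
    walk? zero    p q = map′ (λ { refl → [] , nil , refl }) (λ { ([] , nil , _) → refl }) (p ≟ᶠ q)
    walk? (suc ℓ) p q = map′ (λ (a , r , d , x , px , len) → a ∷ x , step d px , cong suc len)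
                             (λ { (a ∷ x , step d px , len) → a , _ , d , x , px , suc-injective len })
                             (any? λ a → any? λ r → (δ p a r ≟ᵇ true) ×-dec walk? ℓ r q)

    closed-walk-power : ∀ {s e} → Walk s e e → ∀ c → Walk (c * s) e e
    closed-walk-power _ zero    = [] , nil , refl
    closed-walk-power w (suc c) = walk-++ w (closed-walk-power w c)

    module _ (s : ℕ) where

      split-multiple : ∀ {j p q} i → i ≤ j → Walk (j * s) p q →
                       ∃[ r ] (Walk (i * s) p r × Walk ((j ∸ i) * s) r q)
      split-multiple {j} {p} {q} i i≤j w = walk-split (i * s) (subst (λ ℓ → Walk ℓ p q) j*s≡ w)
        where
        j*s≡ : j * s ≡ i * s + (j ∸ i) * s
        j*s≡ = trans (cong (_* s) (sym (m+[n∸m]≡n i≤j))) (*-distribʳ-+ s i (j ∸ i))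

      -- Pigeonhole on the states at the m + 1 checkpoints 0, s, …, m s: a repeated
      -- state bounds a loop whose removal shortens the walk by a positive multiple of s.
      excise : ∀ {j p q} → m ≤ j → Walk (j * s) p q → ∃[ j′ ] (j′ < j × j ≤ j′ + m × Walk (j′ * s) p q)
      excise {j} {p} {q} m≤j w = shorten (pigeonhole (n<1+n m) (λ i → proj₁ (checkpoint i)))
        where
        checkpoint : (i : Fin (suc m)) → ∃[ r ] (Walk (toℕ i * s) p r × Walk ((j ∸ toℕ i) * s) r q)
        checkpoint i = split-multiple (toℕ i) (≤-trans (toℕ≤pred[n] i) m≤j) w

        shorten : (∃₂ λ i i′ → toℕ i < toℕ i′ × proj₁ (checkpoint i) ≡ proj₁ (checkpoint i′)) →
                  ∃[ j′ ] (j′ < j × j ≤ j′ + m × Walk (j′ * s) p q)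
        shorten (i , i′ , a<b , same) = a + (j ∸ b) , shorter , bounded , loopless
          where
          a = toℕ i
          b = toℕ i′
          b≤m : b ≤ m
          b≤m = toℕ≤pred[n] i′
          b≤j : b ≤ j
          b≤j = ≤-trans b≤m m≤j
          shorter : a + (j ∸ b) < j
          shorter = subst (a + (j ∸ b) <_) (m+[n∸m]≡n b≤j) (+-monoˡ-< (j ∸ b) a<b)
          bounded : j ≤ a + (j ∸ b) + m
          bounded = begin
            j                  ≡⟨ m+[n∸m]≡n b≤j ⟨
            b + (j ∸ b)        ≤⟨ +-monoˡ-≤ (j ∸ b) b≤m ⟩
            m + (j ∸ b)        ≤⟨ +-monoʳ-≤ m (m≤n+m (j ∸ b) a) ⟩
            m + (a + (j ∸ b))  ≡⟨ +-comm m (a + (j ∸ b)) ⟩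
            a + (j ∸ b) + m    ∎
            where open ≤-Reasoning
          loopless : Walk ((a + (j ∸ b)) * s) p q
          loopless = subst (λ ℓ → Walk ℓ p q) (sym (*-distribʳ-+ s a (j ∸ b)))
                       (walk-++ (proj₁ (proj₂ (checkpoint i)))
                                (subst (λ r → Walk ((j ∸ b) * s) r q) (sym same) (proj₂ (proj₂ (checkpoint i′)))))

    short-closed-walk : ∀ {ℓ e} → 1 ≤ ℓ → Walk ℓ e e → ∃[ s ] (1 ≤ s × s ≤ m × Walk s e e)
    short-closed-walk {ℓ} = go (<-wellFounded ℓ)
      where
      go : ∀ {ℓ e} → Acc _<_ ℓ → 1 ≤ ℓ → Walk ℓ e e → ∃[ s ] (1 ≤ s × s ≤ m × Walk s e e)
      go {ℓ} {e} (acc rs) 1≤ℓ w with ℓ ≤? m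
      ... | yes ℓ≤m = ℓ , 1≤ℓ , ℓ≤m , w
      ... | no  ℓ≰m with excise 1 (≰⇒≥ ℓ≰m) (subst (λ i → Walk i e e) (sym (*-identityʳ ℓ)) w)
      ...   | j , j<ℓ , ℓ≤j+m , w′ =
        go (rs j<ℓ) (+-cancelʳ-< m 0 j (≤-trans (≰⇒> ℓ≰m) ℓ≤j+m))
                    (subst (λ i → Walk i e e) (*-identityʳ j) w′)

    multiple-walk-stabilises : ∀ {s e} → Walk s e e → ∀ {j r} → Walk (j * s) e r → Walk (m * s) e r
    multiple-walk-stabilises {s} {e} cycle {j} = go (<-wellFounded j)
      where
      go : ∀ {j r} → Acc _<_ j → Walk (j * s) e r → Walk (m * s) e r
      go {j} {r} (acc rs) w with j ≤? m
      ... | yes j≤m = subst (λ ℓ → Walk ℓ e r) padded (walk-++ (closed-walk-power cycle (m ∸ j)) w)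
        where
        padded : (m ∸ j) * s + j * s ≡ m * s
        padded = trans (sym (*-distribʳ-+ s (m ∸ j) j)) (cong (_* s) (m∸n+n≡m j≤m))
      ... | no  j≰m with excise s (≰⇒≥ j≰m) w
      ...   | j′ , j′<j , _ , w′ = go (rs j′<j) w′

  module Periodic {m k : ℕ} (A : NFA m k) (λ′ : ℕ) .{{_ : NonZero λ′}}
                  (sc : StronglyConnected A) (per : IsPeriod A λ′) where
    open NFA A
    open Walks A

    walk-between : ∀ p q → ∃[ ℓ ] Walk ℓ p q
    walk-between p q = length (proj₁ (sc p q)) , proj₁ (sc p q) , proj₂ (sc p q) , refl

    closed-walk-divisible : ∀ {ℓ p} → Walk ℓ p p → λ′ ∣ ℓ
    closed-walk-divisible {zero}           _           = λ′ ∣0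
    closed-walk-divisible {suc ℓ} {p} (w , pw , len) = proj₁ per (suc ℓ) (s≤s z≤n , p , w , pw , len)

    phase : Fin m → ℕ
    phase p = proj₁ (walk-between q₀ p) % λ′

    phase-walk : ∀ {a r} → Walk a q₀ r → phase r ≡ a % λ′
    phase-walk {a} {r} w with walk-between r q₀
    ... | c , back = ∣+∣+⇒%≡ _ a c (closed-walk-divisible (walk-++ (proj₂ (walk-between q₀ r)) back))
                                     (closed-walk-divisible (walk-++ w back))

    phase-q₀ : phase q₀ ≡ 0 % λ′
    phase-q₀ = phase-walk ([] , nil , refl)

    phase-step : ∀ {p r P ℓ} → phase p ≡ P % λ′ → Walk ℓ p r → phase r ≡ (P + ℓ) % λ′
    phase-step {p} {ℓ = ℓ} phase-p w = trans (phase-walk (walk-++ (proj₂ (walk-between q₀ p)) w)) (%-+-congˡ ℓ phase-p)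

    walk-length-congruent : ∀ {e r P G a} → phase e ≡ P % λ′ → phase r ≡ (P + G) % λ′ →
                            Walk a e r → a % λ′ ≡ G % λ′
    walk-length-congruent {P = P} phase-e phase-r w = %-cancelˡ-+ P (trans (sym (phase-step phase-e w)) phase-r)

    -- Without any transition there would be no cycles, and the period would be gcd ∅ = 0.
    positive-closed-walk : ∀ e → ∃[ ℓ ] (1 ≤ ℓ × Walk ℓ e e)
    positive-closed-walk e with any? (λ p → any? λ a → any? λ r → δ p a r ≟ᵇ true)
    ... | yes (p , a , r , d) with walk-between e p | walk-between r e
    ...   | α , to | β , back = α + suc β , ≤-trans (s≤s z≤n) (m≤n+m (suc β) α) ,
                                walk-++ to (walk-++ (a ∷ [] , step d nil , refl) back)
    positive-closed-walk e | no no-transition = contradiction (0∣⇒≡0 (proj₂ per 0 acyclic)) (≢-nonZero⁻¹ λ′)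
      where
      acyclic : ∀ ℓ → CycleLength A ℓ → 0 ∣ ℓ
      acyclic _ (()  , _ , [] , nil , refl)
      acyclic _ (_   , p , a ∷ _ , step d _ , _) = contradiction (p , a , _ , d) no-transition

    module Stabilised (e : Fin m) (s′ : ℕ) (cycle : Walk (suc s′) e e) where
      s N : ℕ
      s = suc s′
      N = m * s

      Late : ℕ → Fin m → Set
      Late x r = Walk (N + x) e r

      absorb : ∀ j {x r} → Walk (j * s + x) e r → Late x r
      absorb j w with walk-split (j * s) w
      ... | _ , prefix , rest = walk-++ (multiple-walk-stabilises cycle {j = j} prefix) rest

      N-loop : Walk N e e
      N-loop = multiple-walk-stabilises cycle {j = 0} ([] , nil , refl)

      late-s : Late s e
      late-s = walk-++ N-loop cycle

      late-+ : ∀ {p x r} → Late p e → Late x r → Late (p + x) r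
      late-+ {p} {x} {r} lp lx = absorb (m + m) (subst (λ ℓ → Walk ℓ e r) (regroup m s p x) (walk-++ lp lx))
        where
        regroup : ∀ m s p x → (m * s + p) + (m * s + x) ≡ (m + m) * s + (p + x)
        regroup = solve-∀

      -- g, the least positive x with e ∈ Late x, is a period of Late and divides every cycle
      -- length, hence λ′.
      module Period (g′ : ℕ) (late-g : Late (suc g′) e) (minimal : ∀ {j} → j < g′ → ¬ Late (suc j) e) where
        g : ℕ
        g = suc g′

        late-+-multiple : ∀ c {x r} → Late x r → Late (c * g + x) r
        late-+-multiple zero    lx = lx
        late-+-multiple (suc c) {x} {r} lx =
          subst (λ y → Late y r) (sym (+-assoc g (c * g) x)) (late-+ late-g (late-+-multiple c lx))

        -- Adding i (s − 1) further multiples of g turns i g into the multiple (i g) s of s,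
        -- which `absorb` removes.
        late-∸-multiple : ∀ i {x r} → Late (i * g + x) r → Late x r
        late-∸-multiple i {x} {r} l =
          absorb (m + i * g) (subst (λ ℓ → Walk ℓ e r) (regroup m s′ g i x) (late-+-multiple (i * s′) l))
          where
          regroup : ∀ m s′ g i x → m * suc s′ + (i * s′ * g + (i * g + x)) ≡ (m + i * g) * suc s′ + x
          regroup = solve-∀

        x≡[x/g]*g+x%g : ∀ x → x ≡ x / g * g + x % g
        x≡[x/g]*g+x%g x = trans (m≡m%n+[m/n]*n x g) (+-comm (x % g) _)

        late-mod : ∀ {x r} → Late x r → Late (x % g) r
        late-mod {x} {r} l = late-∸-multiple (x / g) (subst (λ y → Late y r) (x≡[x/g]*g+x%g x) l)

        late-unmod : ∀ {x r} → Late (x % g) r → Late x r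
        late-unmod {x} {r} l = subst (λ y → Late y r) (sym (x≡[x/g]*g+x%g x)) (late-+-multiple (x / g) l)

        late-divisible : ∀ {j} → Late j e → g ∣ j
        late-divisible {j} l with j % g in eq | late-mod l
        ... | zero  | _  = m%n≡0⇒n∣m j g eq
        ... | suc r | lr = contradiction lr (minimal (s≤s⁻¹ (subst (_< g) eq (m%n<n j g))))

        divides-cycles : ∀ ℓ → CycleLength A ℓ → g ∣ ℓ
        divides-cycles ℓ (_ , x , w , pw , len) with walk-between e x | walk-between x e
        ... | α , to | β , back = ∣m+n∣m⇒∣n (subst (g ∣_) (regroup α ℓ β) around) direct
          where
          regroup : ∀ α ℓ β → α + (ℓ + β) ≡ (α + β) + ℓ
          regroup = solve-∀
          around : g ∣ α + (ℓ + β)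
          around = late-divisible (walk-++ N-loop (walk-++ to (walk-++ (w , pw , len) back)))
          direct : g ∣ α + β
          direct = late-divisible (walk-++ N-loop (walk-++ to back))

        gap-walk : ∀ {a G r} → Walk a e r → a % λ′ ≡ G % λ′ → N ≤ G → Walk G e r
        gap-walk {a} {G} {r} w a≡G N≤G =
          subst (λ ℓ → Walk ℓ e r) (m+[n∸m]≡n N≤G)
                (late-unmod (subst (λ y → Late y r) a≡G-N (late-mod (walk-++ N-loop w))))
          where
          g∣λ′ : g ∣ λ′
          g∣λ′ = proj₂ per g divides-cycles
          g∣N : g ∣ N
          g∣N = ∣n⇒∣m*n m (late-divisible late-s)
          a≡G-N : a % g ≡ (G ∸ N) % g
          a≡G-N = begin
            a % g              ≡⟨ sym (m∣n⇒o%n%m≡o%m g λ′ a g∣λ′) ⟩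
            a % λ′ % g         ≡⟨ cong (_% g) a≡G ⟩
            G % λ′ % g         ≡⟨ m∣n⇒o%n%m≡o%m g λ′ G g∣λ′ ⟩
            G % g              ≡⟨ cong (_% g) (sym (m∸n+n≡m N≤G)) ⟩
            (G ∸ N + N) % g    ≡⟨ %-remove-+ʳ (G ∸ N) g∣N ⟩
            (G ∸ N) % g        ∎
            where open ≡-Reasoning

      gap-walk : ∀ {a G r} → Walk a e r → a % λ′ ≡ G % λ′ → N ≤ G → Walk G e r
      gap-walk with least-witness (λ j → walk? (N + suc j) e e) {s′} late-s
      ... | g′ , late-g , minimal = Period.gap-walk g′ late-g minimal

    gap-walk : ∀ {e r P G} → phase e ≡ P % λ′ → phase r ≡ (P + G) % λ′ → m * m ≤ G → Walk G e r
    gap-walk {e} {r} phase-e phase-r K≤G with walk-between e r | positive-closed-walk e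
    ... | a , w | ℓ , 1≤ℓ , closed with short-closed-walk 1≤ℓ closed
    ...   | suc s′ , _ , s≤m , cycle =
      Stabilised.gap-walk e s′ cycle w (walk-length-congruent phase-e phase-r w) (≤-trans (*-monoʳ-≤ m s≤m) K≤G)

  module Readability {m k : ℕ} (A : NFA m k) (λ′ : ℕ) .{{_ : NonZero λ′}}
                     (sc : StronglyConnected A) (per : IsPeriod A λ′) where
    open NFA A
    open Walks A
    open Periodic A λ′ sc per
    open Positional λ′ {k}

    phase-surjective : ∀ T → ∃[ p ] phase p ≡ T % λ′
    phase-surjective T with positive-closed-walk q₀
    ... | suc ℓ , _ , closed with walk-split T (subst (λ i → Walk i q₀ q₀) T*ℓ≡ (closed-walk-power closed T))
      where
      T*ℓ≡ : T * suc ℓ ≡ T + (T * suc ℓ ∸ T)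
      T*ℓ≡ = sym (m+[n∸m]≡n (m≤m*n T (suc ℓ)))
    ... | p , prefix , _ = p , phase-walk prefix

    ReadableAt : ℕ → List (Fin k) → Set
    ReadableAt T x = ∃[ p ] (phase p ≡ T % λ′ × ∃[ q ] Path A p x q)

    readableAt? : ∀ T x → Dec (ReadableAt T x)
    readableAt? T x = any? λ p → (phase p ≟ T % λ′) ×-dec readable? p x

    readableAt-[] : ∀ T → ReadableAt T []
    readableAt-[] T = proj₁ (phase-surjective T) , proj₂ (phase-surjective T) , _ , nil

    unreadable⇒blocking : ∀ T y → y ≢ [] → ¬ ReadableAt T y → Blocking A λ′ ⟨ T ∶ y ⟩
    unreadable⇒blocking T y y≢[] unreadable σ (P , S , σ≡) (v , (_ , pv , _) , σ≡v)
      with ⟨⟩-factor 0 v P (trans (sym σ≡v) σ≡) y≢[]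
    ... | v₁ , v₂ , refl , position with path-split v₁ pv
    ... | r , p₁ , p₂ with path-split y p₂
    ... | q , py , _ = unreadable (r , trans (phase-walk (v₁ , p₁ , refl)) position , q , py)

    data Factorisation : ℕ → List (Fin k) → ℕ → Set where
      readable : ∀ {T z} → ReadableAt T z → Factorisation T z 0
      blocked  : ∀ {T x a z t} → ReadableAt T x → ¬ ReadableAt T (x ∷ʳ a) →
                 Factorisation (T + length (x ∷ʳ a)) z t → Factorisation T (x ++ a ∷ z) (suc t)

    factorise : ∀ T z → ∃[ t ] Factorisation T z t
    factorise T z = go T z (<-wellFounded (length z))
      where
      go : ∀ T z → Acc _<_ (length z) → ∃[ t ] Factorisation T z t
      go T z (acc rs) with prefix-breakpoint (readableAt? T) (readableAt-[] T) z
      ... | inj₁ rz = 0 , readable rz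
      ... | inj₂ (x , a , z′ , refl , rx , ¬rxa) with go (T + length (x ∷ʳ a)) z′ (rs shorter)
        where
        shorter : length z′ < length (x ++ a ∷ z′)
        shorter = subst (length z′ <_) (sym (length-++ x)) (m≤n+m (suc (length z′)) (length x))
      ...   | t , f = suc t , blocked rx ¬rxa f

    module _ (u : List (Fin k)) where

      blocking-occurrences : ∀ pre {z t} → u ≡ pre ++ z → Factorisation (length pre) z t →
        ∃[ occs ] (length occs ≡ t × AllPairs DisjointOcc occs × All (BlockingOcc A λ′ ⟨ 0 ∶ u ⟩) occs
                   × All (λ o → length pre ≤ proj₁ o) occs)
      blocking-occurrences pre u≡ (readable _) = [] , refl , [] , [] , []
      blocking-occurrences pre u≡ (blocked {x = x} {a} {z′} {t} _ ¬rxa f)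
        with blocking-occurrences (pre ++ x ∷ʳ a) u≡′ (subst (λ T → Factorisation T z′ t) (sym (length-++ pre)) f)
        where
        u≡′ : u ≡ (pre ++ x ∷ʳ a) ++ z′
        u≡′ = trans u≡ (trans (cong (pre ++_) (sym (∷ʳ-++ x a z′))) (sym (++-assoc pre (x ∷ʳ a) z′)))
      ... | occs , refl , disjoint , blocking , after =
        (length pre , length (x ∷ʳ a)) ∷ occs , refl ,
        All.map (λ o-after → inj₁ (subst (_≤ _) (length-++ pre) o-after)) after ∷ disjoint ,
        occurrence ∷ blocking ,
        ≤-refl ∷ All.map (λ o-after → ≤-trans (m≤m+n _ _) (subst (_≤ _) (length-++ pre) o-after)) after
        where
        u≡″ : u ≡ pre ++ (x ∷ʳ a) ++ z′
        u≡″ = trans u≡ (cong (pre ++_) (sym (∷ʳ-++ x a z′)))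
        nonempty : x ∷ʳ a ≢ []
        nonempty eq with ++-conicalʳ x (a ∷ []) eq
        ... | ()
        in-range : length pre + length (x ∷ʳ a) ≤ length ⟨ 0 ∶ u ⟩
        in-range = begin
          length pre + length (x ∷ʳ a)          ≤⟨ +-monoʳ-≤ (length pre) (length-++-≤ˡ (x ∷ʳ a)) ⟩
          length pre + length ((x ∷ʳ a) ++ z′)  ≡⟨ sym (length-++ pre) ⟩
          length (pre ++ (x ∷ʳ a) ++ z′)        ≡⟨ cong length (sym u≡″) ⟩
          length u                              ≡⟨ sym (length-⟨⟩ 0 u) ⟩
          length ⟨ 0 ∶ u ⟩                      ∎
          where open ≤-Reasoning
        sliced : slice (length pre , length (x ∷ʳ a)) ⟨ 0 ∶ u ⟩ ≡ ⟨ length pre ∶ x ∷ʳ a ⟩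
        sliced = trans (cong (λ w → slice (length pre , length (x ∷ʳ a)) ⟨ 0 ∶ w ⟩) u≡″) (slice-⟨⟩ pre (x ∷ʳ a) z′)
        occurrence : BlockingOcc A λ′ ⟨ 0 ∶ u ⟩ (length pre , length (x ∷ʳ a))
        occurrence = subst (1 ≤_) (sym (length-++ x)) (m≤n+m 1 (length x)) , in-range ,
                     subst (Blocking A λ′) (sym sliced) (unreadable⇒blocking (length pre) (x ∷ʳ a) nonempty ¬rxa)

  module Approximation {m k : ℕ} (A : NFA m k) (λ′ : ℕ) .{{_ : NonZero λ′}}
                       (sc : StronglyConnected A) (per : IsPeriod A λ′)
                       (n : ℕ) (f₀ : Fin m) (phase-f₀ : Periodic.phase A λ′ sc per f₀ ≡ n % λ′) where
    open Walks A
    open Periodic A λ′ sc per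
    open Readability A λ′ sc per

    K : ℕ
    K = m * m

    record Approx (e : Fin m) (w : List (Fin k)) (c : ℕ) : Set where
      constructor approx
      field
        word        : List (Fin k)
        run         : Path A e word f₀
        same-length : length word ≡ length w
        close       : mismatches w word ≤ c

    approx-weaken : ∀ {e w c c′} → c ≤ c′ → Approx e w c → Approx e w c′
    approx-weaken c≤c′ (approx v pv len mis) = approx v pv len (≤-trans mis c≤c′)

    approx-by-gap : ∀ {e Q w} → phase e ≡ Q % λ′ → Q + length w ≡ n → K ≤ length w → Approx e w (length w)
    approx-by-gap {w = w} phase-e Q+w≡n K≤w with gap-walk phase-e (trans phase-f₀ (cong (_% λ′) (sym Q+w≡n))) K≤w
    ... | v , pv , len = approx v pv len (mismatches≤length w v)

    approx-gap : ∀ {e r Q c} g {w} → phase e ≡ Q % λ′ → phase r ≡ (Q + length g) % λ′ → K ≤ length g →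
                 Approx r w c → Approx e (g ++ w) (length g + c)
    approx-gap g {w} phase-e phase-r K≤g (approx v pv len mis) with gap-walk phase-e phase-r K≤g
    ... | v₁ , p₁ , len₁ = approx (v₁ ++ v) (path-++ p₁ pv) (length-++-cong v₁ g v w len₁ len)
      (≤-trans (≤-reflexive (mismatches-++ g v₁ (sym len₁))) (+-mono-≤ (mismatches≤length g v₁) mis))

    approx-follow : ∀ {e r c} y {w} → Path A e y r → Approx r w c → Approx e (y ++ w) c
    approx-follow y {w} py (approx v pv len mis) = approx (y ++ v) (path-++ py pv) (length-++-cong y y v w refl len)
      (≤-trans (≤-reflexive (trans (mismatches-++ y y refl) (cong (_+ mismatches w v) (mismatches-refl y)))) mis)

    -- The gap replaces mid together with the first K ∸ |mid| letters of x.
    approx-through : ∀ {e Q p q P c} mid x w → phase e ≡ Q % λ′ → Q + length mid ≡ P →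
                     phase p ≡ P % λ′ → Path A p x q → K ≤ length mid + length x →
                     Approx q w c → Approx e (mid ++ x ++ w) (length mid + K + c)
    approx-through {e} {Q} {c = c} mid x w phase-e Q+mid≡P phase-p px K≤mid+x approx-q
      with split-at (K ∸ length mid) x (m≤n+o⇒m∸n≤o K (length mid) K≤mid+x)
    ... | x₁ , x₂ , refl , len₁ with path-split x₁ px
    ... | r , p₁ , p₂ = subst (λ w′ → Approx e w′ _) regroup
                          (approx-weaken cost (approx-gap (mid ++ x₁) phase-e phase-r K≤gap (approx-follow x₂ p₂ approx-q)))
      where
      gap-length : length (mid ++ x₁) ≡ length mid + (K ∸ length mid)
      gap-length = trans (length-++ mid) (cong (length mid +_) len₁)
      phase-r : phase r ≡ (Q + length (mid ++ x₁)) % λ′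
      phase-r = trans (phase-step phase-p (x₁ , p₁ , refl)) (cong (_% λ′) (sym (+-length-++ mid x₁ Q+mid≡P refl)))
      K≤gap : K ≤ length (mid ++ x₁)
      K≤gap = subst (K ≤_) (sym gap-length) (m≤n+m∸n K (length mid))
      cost : length (mid ++ x₁) + c ≤ length mid + K + c
      cost = +-monoˡ-≤ c (subst (_≤ length mid + K) (sym gap-length) (+-monoʳ-≤ (length mid) (m∸n≤m K (length mid))))
      regroup : (mid ++ x₁) ++ x₂ ++ w ≡ mid ++ (x₁ ++ x₂) ++ w
      regroup = trans (++-assoc mid x₁ (x₂ ++ w)) (cong (mid ++_) (sym (++-assoc x₁ x₂ w)))

    -- Either one gap covers everything, or a first gap leads into x and a final gap of
    -- length exactly K reaches f₀.
    approx-readable-prefix : ∀ {e Q p q P z} mid x y → z ≡ x ++ y → phase e ≡ Q % λ′ → Q + length mid ≡ P →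
                             phase p ≡ P % λ′ → Path A p x q → P + length z ≡ n →
                             K ≤ length (mid ++ z) → length y ≤ K →
                             Approx e (mid ++ z) (length mid + (K + K))
    approx-readable-prefix {e} {P = P} mid x y refl phase-e Q+mid≡P phase-p px P+xy≡n room y≤K with length (x ++ y) ≤? K + K
    ... | yes short =
      approx-weaken (≤-trans (≤-reflexive (length-++ mid)) (+-monoʳ-≤ (length mid) short))
                    (approx-by-gap phase-e (+-length-++ mid (x ++ y) Q+mid≡P P+xy≡n) room)
    ... | no long with split-at (length (x ++ y) ∸ K) x fits
      where
      fits : length (x ++ y) ∸ K ≤ length x
      fits = m≤n+o⇒m∸n≤o (length (x ++ y)) K (begin
        length (x ++ y)      ≡⟨ length-++ x ⟩
        length x + length y  ≤⟨ +-monoʳ-≤ (length x) y≤K ⟩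
        length x + K         ≡⟨ +-comm (length x) K ⟩
        K + length x         ∎)
        where open ≤-Reasoning
    ... | x′ , x″ , refl , len′ with path-split x′ px
    ... | r , p′ , _ = subst (λ w′ → Approx e w′ _) regroup
                         (approx-weaken cost (approx-through mid x′ (x″ ++ y) phase-e Q+mid≡P phase-p p′ K≤mid+x′
                           (approx-by-gap (phase-step phase-p (x′ , p′ , refl)) position (≤-reflexive (sym rest-length)))))
      where
      L = length ((x′ ++ x″) ++ y)
      position : P + length x′ + length (x″ ++ y) ≡ n
      position = trans (sym (+-length-++ x′ (x″ ++ y) refl refl))
                       (trans (cong (λ w → P + length w) (sym (++-assoc x′ x″ y))) P+xy≡n)
      K≤x′ : K ≤ length x′
      K≤x′ = subst (K ≤_) (sym len′) (m+n≤o⇒m≤o∸n K (<⇒≤ (≰⇒> long)))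
      K≤mid+x′ : K ≤ length mid + length x′
      K≤mid+x′ = ≤-trans K≤x′ (m≤n+m (length x′) (length mid))
      rest-length : length (x″ ++ y) ≡ K
      rest-length = +-cancelˡ-≡ (length x′) _ _ (begin
        length x′ + length (x″ ++ y)   ≡⟨ sym (length-++ x′) ⟩
        length (x′ ++ x″ ++ y)         ≡⟨ cong length (sym (++-assoc x′ x″ y)) ⟩
        L                              ≡⟨ sym (m∸n+n≡m (≤-trans (m≤m+n K K) (<⇒≤ (≰⇒> long)))) ⟩
        L ∸ K + K                      ≡⟨ cong (_+ K) (sym len′) ⟩
        length x′ + K                  ∎)
        where open ≡-Reasoning
      regroup : mid ++ x′ ++ x″ ++ y ≡ mid ++ (x′ ++ x″) ++ y
      regroup = cong (mid ++_) (sym (++-assoc x′ x″ y))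
      cost : length mid + K + length (x″ ++ y) ≤ length mid + (K + K)
      cost = ≤-reflexive (trans (cong (length mid + K +_) rest-length) (+-assoc (length mid) K K))

    after-block : ∀ P (x : List (Fin k)) a z′ → P + length (x ++ a ∷ z′) ≡ n →
                  P + length (x ∷ʳ a) + length z′ ≡ n
    after-block P x a z′ P+z≡n =
      +-length-++⁻ (x ∷ʳ a) z′ (subst (λ w → P + length w ≡ n) (sym (∷ʳ-++ x a z′)) P+z≡n)

    -- Each blocking factor costs one gap of K letters plus its last letter; the gaps at both
    -- ends cost K each.
    budget : ℕ → ℕ
    budget t = t * suc K + (K + K)

    -- mid is a stretch already given up: it is overwritten by the next gap walk.
    approx-factorisation : ∀ {P z t} → Factorisation P z t → ∀ {e Q} mid → phase e ≡ Q % λ′ → Q + length mid ≡ P →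
                           P + length z ≡ n → K ≤ length (mid ++ z) → Approx e (mid ++ z) (length mid + budget t)
    approx-factorisation {z = z} (readable (p , phase-p , q , pz)) mid phase-e Q+mid≡P P+z≡n room =
      approx-readable-prefix mid z [] (sym (++-identityʳ z)) phase-e Q+mid≡P phase-p pz P+z≡n room z≤n
    approx-factorisation {P} (blocked {x = x} {a} {z′} {t} (p , phase-p , q , px) _ f) {e} mid phase-e Q+mid≡P P+z≡n room
      with K ≤? length mid + length x | K ≤? length (a ∷ z′)
    ... | no short | _ =
      subst (λ w → Approx e w _) regroup
        (approx-weaken cost (approx-factorisation f (mid ++ x ∷ʳ a) phase-e (+-length-++ mid (x ∷ʳ a) Q+mid≡P refl)
                                                  (after-block P x a z′ P+z≡n) (subst (λ w → K ≤ length w) (sym regroup) room)))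
      where
      regroup : (mid ++ x ∷ʳ a) ++ z′ ≡ mid ++ x ++ a ∷ z′
      regroup = trans (++-assoc mid (x ∷ʳ a) z′) (cong (mid ++_) (∷ʳ-++ x a z′))
      cost : length (mid ++ x ∷ʳ a) + budget t ≤ length mid + budget (suc t)
      cost = begin
        length (mid ++ x ∷ʳ a) + budget t
          ≡⟨ cong (_+ budget t) (trans (length-++ mid) (cong (length mid +_) (length-++ x))) ⟩
        length mid + (length x + 1) + budget t
          ≤⟨ +-monoˡ-≤ (budget t) (+-monoʳ-≤ (length mid) (≤-trans x+1≤K (n≤1+n K))) ⟩
        length mid + suc K + budget t
          ≡⟨ +-assoc (length mid) (suc K) (budget t) ⟩
        length mid + (suc K + budget t)
          ≡⟨ cong (length mid +_) (sym (+-assoc (suc K) (t * suc K) (K + K))) ⟩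
        length mid + budget (suc t) ∎
        where
        open ≤-Reasoning
        x+1≤K : length x + 1 ≤ K
        x+1≤K = subst (_≤ K) (+-comm 1 (length x)) (≤-trans (s≤s (m≤n+m (length x) (length mid))) (≰⇒> short))
    ... | yes long | yes room′ =
      approx-weaken (≤-reflexive (regroup (length mid) K (t * suc K)))
        (approx-through mid x (a ∷ z′) phase-e Q+mid≡P phase-p px long
          (approx-factorisation f (a ∷ []) (phase-step phase-p (x , px , refl)) (sym (+-length-++ x (a ∷ []) refl refl))
                                (after-block P x a z′ P+z≡n) room′))
      where
      regroup : ∀ m K t → m + K + (1 + (t + (K + K))) ≡ m + ((suc K + t) + (K + K))
      regroup = solve-∀
    ... | yes _ | no no-room =
      approx-weaken (+-monoʳ-≤ (length mid) (m≤n+m (K + K) (suc t * suc K)))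
        (approx-readable-prefix mid x (a ∷ z′) refl phase-e Q+mid≡P phase-p px P+z≡n room (<⇒≤ (≰⇒> no-room)))

    greedy-blocking-factors : ∀ u → length u ≡ n → K ≤ n →
      ∃[ occs ] (AllPairs DisjointOcc occs × All (BlockingOcc A λ′ ⟨ 0 ∶ u ⟩) occs ×
                 ∃[ v ] (Path A (NFA.q₀ A) v f₀ × length v ≡ length u × mismatches u v ≤ budget (length occs)))
    greedy-blocking-factors u |u|≡n K≤n with factorise 0 u
    ... | t , f with blocking-occurrences u [] refl f
    ... | occs , refl , disjoint , blocking , _
      with approx-factorisation f [] phase-q₀ refl |u|≡n (subst (K ≤_) (sym |u|≡n) K≤n)
    ... | approx v run len close = occs , disjoint , blocking , v , run , len , close

  budget≤6m²t : ∀ {m h} .{{_ : NonZero m}} t → 6 * m * m ≤ h → h ≤ t * suc (m * m) + (m * m + m * m) →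
                h ≤ 6 * m * m * t
  budget≤6m²t {suc m} {h} zero 6m²≤h h≤2m² =
    contradiction (≤-trans (subst (_≤ h) (split m) 6m²≤h) h≤2m²) (m+1+n≰m _)
    where
    split : ∀ m → 6 * suc m * suc m ≡ (suc m * suc m + suc m * suc m) + suc (4 * m * m + 8 * m + 3)
    split = solve-∀
  budget≤6m²t {suc m} {h} (suc t) _ h≤budget = begin
    h                                                                ≤⟨ h≤budget ⟩
    suc t * suc (suc m * suc m) + (suc m * suc m + suc m * suc m)    ≤⟨ m≤m+n _ _ ⟩
    suc t * suc (suc m * suc m) + (suc m * suc m + suc m * suc m)
      + (5 * m * m * t + 10 * m * t + 4 * t + 3 * m * m + 6 * m + 2) ≡⟨ split m t ⟩
    6 * suc m * suc m * suc t                                        ∎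
    where
    open ≤-Reasoning
    split : ∀ m t → suc t * suc (suc m * suc m) + (suc m * suc m + suc m * suc m)
                      + (5 * m * m * t + 10 * m * t + 4 * t + 3 * m * m + 6 * m + 2)
                    ≡ 6 * suc m * suc m * suc t
    split = solve-∀

  module _ {m k : ℕ} (A : NFA m k) (λ′ : ℕ) .{{_ : NonZero λ′}}
           (sc : StronglyConnected A) (per : IsPeriod A λ′) where
    open NFA A
    open Periodic A λ′ sc per

    many-blocking-factors : ∀ u {w₀} → Accepts A w₀ → length w₀ ≡ length u →
      (∀ {v} → Accepts A v → length v ≡ length u → 6 * m * m ≤ mismatches u v) →
      ∃[ occs ] (AllPairs DisjointOcc occs × All (BlockingOcc A λ′ ⟨ 0 ∶ u ⟩) occs ×
                 ∃[ v ] (Accepts A v × length v ≡ length u × mismatches u v ≤ 6 * m * m * length occs))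
    many-blocking-factors u {w₀} (f₀ , pw₀ , final) |w₀|≡|u| far
      with greedy-blocking-factors u refl K≤|u|
      where
      open Approximation A λ′ sc per (length u) f₀ (phase-walk (w₀ , pw₀ , |w₀|≡|u|))
      K≤|u| : K ≤ length u
      K≤|u| = ≤-trans (*-monoˡ-≤ m (m≤n*m m 6))
                      (≤-trans (far (f₀ , pw₀ , final) |w₀|≡|u|) (mismatches≤length u w₀))
    ... | occs , disjoint , blocking , v , run , len , close =
      occs , disjoint , blocking , v , (f₀ , run , final) , len ,
      budget≤6m²t {{nonZeroIndex q₀}} (length occs) (far (f₀ , run , final) len) close

open import Data.Nat using (ℕ; _*_; NonZero)
open import Data.Nat using () renaming (_≤_ to _≤ℕ_)
open import Data.Integer using (+_)
open import Data.Rational using (ℚ; 0ℚ; _/_; _<_; _≤_) renaming (_*_ to _*ℚ_)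
open import Data.Fin using (Fin)
open import Data.List using (List; length)
open import Data.List.Relation.Unary.All using (All)
open import Data.List.Relation.Unary.AllPairs using (AllPairs)
open import Data.Product using (∃; ∃-syntax; _×_; _,_)
open import Data.Rational.Properties using (≤-trans)
open import Relation.Binary.PropositionalEquality using (_≡_; refl; sym; trans; subst)

far-from-accepted : ∀ {m k} (A : NFA m k) (λ′ : ℕ) .{{_ : NonZero λ′}} {r : ℚ} (u : List (Fin k)) →
  (∀ σ → InLhat A λ′ σ → length σ ≡ length (⟨_∶_⟩ {λ′} 0 u) →
     r ≤ (+ hamming (⟨_∶_⟩ {λ′} 0 u) σ / 1)) →
  ∀ {v} → Accepts A v → length v ≡ length u → r ≤ + mismatches u v / 1
far-from-accepted A λ′ {r} u far {v} acc |v|≡|u| =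
  subst (λ h → r ≤ + h / 1) (hamming-⟨⟩ 0 u v)
    (far ⟨ 0 ∶ v ⟩ (v , acc , refl) (trans (length-⟨⟩ 0 v) (trans |v|≡|u| (sym (length-⟨⟩ 0 u)))))
  where open Positional λ′

lemma18 : ∀ {m k : ℕ} (A : NFA m k) (λ′ : ℕ) .{{_ : NonZero λ′}} →
    StronglyConnected A → IsPeriod A λ′ →
    (ε : ℚ) → 0ℚ < ε →
    (n : ℕ) (u : List (Fin k)) → length u ≡ n →
    (+ (6 * m * m) / 1) ≤ ε *ℚ (+ n / 1) →
    (∃[ w ] (Accepts A w × length w ≡ n)) →
    (∀ σ → InLhat A λ′ σ → length σ ≡ length (⟨_∶_⟩ {λ′} 0 u) →
       ε *ℚ (+ n / 1) ≤ (+ hamming (⟨_∶_⟩ {λ′} 0 u) σ / 1)) →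
    ∃[ occs ] (AllPairs DisjointOcc occs
              × All (BlockingOcc A λ′ (⟨_∶_⟩ {λ′} 0 u)) occs
              × ε *ℚ (+ n / 1) ≤ (+ (6 * m * m * length occs) / 1))
lemma18 {m} A λ′ sc per ε _ _ u refl 6m²≤εn (_ , accepted , |w₀|≡n) far =
  let occs , disjoint , blocking , v , acc , |v|≡n , close =
        many-blocking-factors A λ′ sc per u accepted |w₀|≡n many-mismatches
  in  occs , disjoint , blocking , ≤-trans (far-from-accepted A λ′ u far acc |v|≡n) (/1-mono-≤ close)
  where
  many-mismatches : ∀ {v} → Accepts A v → length v ≡ length u → 6 * m * m ≤ℕ mismatches u v
  many-mismatches {v} acc |v|≡n =
    /1-cancel-≤ (≤-trans 6m²≤εn (far-from-accepted A λ′ u far acc |v|≡n))
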